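{- Let $V$ be a quasivariety such that $I$ is finitely presented in $V$. Then there exists a computable function $g$ such that for every maximal element $X$ of $V$ with $X\neq I$, we have $\overline{X}\le_e^g X$, where $\overline{X}=I\setminus X$.
   Context: $I$ is a computable countable set identified with $\mathbb{N}$. A quasivariety $V$ is given by a recursively enumerable set $S$ of finite sequences $(n_0,\dots,n_k)$ of elements of $I$: $V$ is the set of all $X\subseteq I$ such that for every $(n_0,\dots,n_k)\in S$, if $n_1,\dots,n_k\in X$ then $n_0\in X$. $V$ contains $I$ and is closed under arbitrary intersections. A presentation of $X\in V$ is a set $Y\subseteq I$ such that $X$ is the smallest element of $V$ containing $Y$; "$I$ is finitely presented" means there is a finite set $A\subseteq I$ such that the only element of $V$ containing $A$ is $I$. An element $X\in V$ is maximal if whenever $Y\in V$ and $X\subseteq Y$, then $Y=X$ or $Y=I$. For $A,B\subseteq I$ and a computable $g: I\times\mathbb{N}\to P_f(I)\cup\{\{\bot\}\}$ (with $P_f(I)$ a recursive encoding of finite subsets of $I$, $\bot\notin I$), $A\le_e^g B$ means: for all $x$, $x\in A\iff \exists n,\ g(x,n)\subseteq B$. -}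

module Defs where

open import Data.Nat using (ℕ)
open import Data.List using (List)
open import Data.List.Relation.Unary.All using (All)
open import Data.Maybe using (Maybe; just; nothing)
open import Data.Product using (_×_; Σ; ∃; _,_)
open import Data.Unit using (⊤)
open import Data.Sum using (_⊎_)
open import Data.Empty using (⊥)
open import Relation.Nullary using (¬_)

-- The index set I is identified with ℕ.  Subsets of I are predicates.
Subset : Set₁
Subset = ℕ → Set

_∈_ : ℕ → Subset → Set
n ∈ X = X n

_⊆_ : Subset → Subset → Set
X ⊆ Y = ∀ n → n ∈ X → n ∈ Y

_≐_ : Subset → Subset → Set
X ≐ Y = (X ⊆ Y) × (Y ⊆ X)

Whole : Subset
Whole _ = ⊤

_⊆ₗ_ : List ℕ → Subset → Set
A ⊆ₗ X = All (λ n → n ∈ X) A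

-- A recursively enumerable set S of finite nonempty sequences (n₀,n₁,…,nₖ)
-- is given by a (computable, i.e. Agda) enumeration
--   e : ℕ → Maybe (ℕ × List ℕ),
-- where  e m = just (n₀ , [n₁,…,nₖ])  lists an element of S and
-- e m = nothing  is a "skip" (allowing S to be empty or finite).
-- S = { e m | m : ℕ, e m ≠ nothing }.
REnum : Set
REnum = ℕ → Maybe (ℕ × List ℕ)

SatRule : Maybe (ℕ × List ℕ) → Subset → Set
SatRule nothing        X = ⊤
SatRule (just (h , ps)) X = ps ⊆ₗ X → h ∈ X

InV : REnum → Subset → Set
InV e X = ∀ m → SatRule (e m) X

FinitelyPresented : REnum → Set₁
FinitelyPresented e =
  Σ (List ℕ) λ A → ∀ (Y : Subset) → InV e Y → A ⊆ₗ Y → Y ≐ Whole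

Maximal : REnum → Subset → Set₁
Maximal e X =
  InV e X × (∀ (Y : Subset) → InV e Y → X ⊆ Y → (Y ≐ X) ⊎ (Y ≐ Whole))

Compl : Subset → Subset
Compl X n = ¬ (n ∈ X)

-- g : I × ℕ → P_f(I) ∪ {{⊥}} ; finite subsets of I are encoded as lists,
-- and  nothing  encodes the set {⊥}.
EnumOp : Set
EnumOp = ℕ → ℕ → Maybe (List ℕ)

-- "g(x,n) ⊆ B":  {⊥} ⊆ B never holds since ⊥ ∉ I.
_⊑_ : Maybe (List ℕ) → Subset → Set
nothing ⊑ B = ⊥
just F  ⊑ B = F ⊆ₗ B

_≤e[_]_ : Subset → EnumOp → Subset → Set
A ≤e[ g ] B = ∀ x → (x ∈ A → ∃ λ n → g x n ⊑ B) × ((∃ λ n → g x n ⊑ B) → x ∈ A)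

-- If x ∉ X, maximality forces the closure of X ∪ {x} in V to be all of I, so it contains the
-- finite presentation A.  By compactness A is then derived from x and a finite F ⊆ X by finitely
-- many rule applications, and g enumerates the pairs (F , number of rounds) and computably checks
-- the derivation.  Conversely, if x ∈ X then every such derivation stays inside X ∈ V, which
-- would then contain A and hence equal I.
module Submission where

open import Defs
open import Data.Empty using (⊥-elim)
open import Data.List using (List; []; _∷_; _++_; length)
open import Data.List.Membership.Propositional using () renaming (_∈_ to _∈ₗ_)
open import Data.List.Membership.Propositional.Properties using (∈-++⁺ˡ; ∈-++⁺ʳ; ∈-++⁻)
open import Data.List.Relation.Binary.Subset.Propositional using () renaming (_⊆_ to _⊆ᴸ_)
open import Data.List.Relation.Binary.Subset.Propositional.Properties
  using (xs⊆xs++ys; xs⊆ys++xs; ++⁺ʳ) renaming (++⁺ to ++-mono)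
open import Data.List.Relation.Unary.All as All using (All; []; _∷_; all?)
open import Data.List.Relation.Unary.All.Properties using (++⁺)
open import Data.List.Relation.Unary.Any using (here)
open import Data.Maybe using (Maybe; just; nothing)
open import Data.Nat using (ℕ; _≟_; zero; suc; _+_; _⊔_; _≤_; _<_; _≤′_; ≤′-refl; ≤′-step)
open import Data.List.Membership.DecPropositional _≟_ using (_∈?_)
open import Data.Nat.Properties
  using (+-suc; +-identityʳ; suc-injective; m≤m⊔n; m≤n⊔m; n<1+n; m<n⇒m<1+n; ≤⇒≤′; m<1+n⇒m<n∨m≡n)
open import Data.Product using (Σ; ∃; ∃₂; _×_; _,_; proj₁; proj₂; map; map₂; uncurry)
open import Data.Sum using (_⊎_; inj₁; inj₂)
open import Data.Unit using (tt)
open import Function using (_∘_)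
open import Relation.Binary.PropositionalEquality using (_≡_; refl; cong; trans; sym; subst)
open import Relation.Nullary using (¬_; yes; no)

-- Cantor's diagonal enumeration of ℕ × ℕ, walking each diagonal a + b = s upwards in a.
next : ℕ × ℕ → ℕ × ℕ
next (a , suc b) = suc a , b
next (a , zero)  = zero , suc a

unpair : ℕ → ℕ × ℕ
unpair zero    = 0 , 0
unpair (suc n) = next (unpair n)

unpair-surjective : ∀ a b → ∃ λ n → unpair n ≡ (a , b)
unpair-surjective a b = onDiagonal (a + b) a b refl
  where
  onDiagonal : ∀ s a b → a + b ≡ s → ∃ λ n → unpair n ≡ (a , b)
  onDiagonal s       (suc a) b       eq =
    map suc (cong next) (onDiagonal s a (suc b) (trans (+-suc a b) eq))
  onDiagonal zero    zero    zero    _  = 0 , refl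
  onDiagonal (suc s) zero    (suc b) eq =
    map suc (cong next) (onDiagonal s b 0 (trans (+-identityʳ b) (suc-injective eq)))

unfoldList : ℕ → ℕ → List ℕ
unfoldList zero    c = []
unfoldList (suc l) c = proj₁ (unpair c) ∷ unfoldList l (proj₂ (unpair c))

unfoldList-surjective : ∀ xs → ∃ λ c → unfoldList (length xs) c ≡ xs
unfoldList-surjective []       = 0 , refl
unfoldList-surjective (a ∷ xs) with unfoldList-surjective xs
... | c , unfold-c with unpair-surjective a c
... | n , unpair-n =
  n , trans (cong (λ p → proj₁ p ∷ unfoldList (length xs) (proj₂ p)) unpair-n) (cong (a ∷_) unfold-c)

decode : ℕ → ℕ × List ℕ
decode = map₂ (uncurry unfoldList ∘ unpair) ∘ unpair

decode-surjective : ∀ k F → ∃ λ n → decode n ≡ (k , F)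
decode-surjective k F with unfoldList-surjective F
... | c , unfold-c with unpair-surjective (length F) c
... | r , unpair-r with unpair-surjective k r
... | n , unpair-n =
  n , trans (cong (map₂ (uncurry unfoldList ∘ unpair)) unpair-n)
            (cong (k ,_) (trans (cong (uncurry unfoldList) unpair-r) unfold-c))

module Stages (e : REnum) where

  fire : List ℕ → Maybe (ℕ × List ℕ) → List ℕ
  fire L nothing = []
  fire L (just (h , ps)) with all? (_∈? L) ps
  ... | yes _ = h ∷ []
  ... | no _  = []

  consequences : List ℕ → ℕ → List ℕ
  consequences L zero    = []
  consequences L (suc m) = fire L (e m) ++ consequences L m

  -- Round k fires only the rules e 0, …, e (k - 1), so every stage is a finite, computable list.
  stage : ℕ → List ℕ → List ℕ
  stage zero    L = L
  stage (suc k) L = stage k L ++ consequences (stage k L) k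

  Applicable : List ℕ → ℕ → ℕ → Set
  Applicable L m h = ∃₂ λ i ps → i < m × e i ≡ just (h , ps) × All (_∈ₗ L) ps

  ∈-fire⁺ : ∀ {L h ps} → All (_∈ₗ L) ps → h ∈ₗ fire L (just (h , ps))
  ∈-fire⁺ {L} {h} {ps} ps⊆L with all? (_∈? L) ps
  ... | yes _    = here refl
  ... | no ps⊈L  = ⊥-elim (ps⊈L ps⊆L)

  ∈-fire⁻ : ∀ {L h} r → h ∈ₗ fire L r → ∃ λ ps → r ≡ just (h , ps) × All (_∈ₗ L) ps
  ∈-fire⁻ {L} (just (c , ps)) h∈ with all? (_∈? L) ps | h∈
  ... | yes ps⊆L | here refl = ps , refl , ps⊆L

  ∈-consequences⁺ : ∀ {L m h} → Applicable L m h → h ∈ₗ consequences L m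
  ∈-consequences⁺ {L} {suc m} (i , ps , i<1+m , eq , ps⊆L) with m<1+n⇒m<n∨m≡n i<1+m
  ... | inj₁ i<m  = ∈-++⁺ʳ (fire L (e m)) (∈-consequences⁺ (i , ps , i<m , eq , ps⊆L))
  ... | inj₂ refl = ∈-++⁺ˡ (subst (λ r → _ ∈ₗ fire L r) (sym eq) (∈-fire⁺ ps⊆L))

  ∈-consequences⁻ : ∀ {L h} m → h ∈ₗ consequences L m → Applicable L m h
  ∈-consequences⁻ {L} (suc m) h∈ with ∈-++⁻ (fire L (e m)) h∈
  ... | inj₁ h∈fire = let ps , eq , ps⊆L = ∈-fire⁻ (e m) h∈fire
                      in m , ps , n<1+n m , eq , ps⊆L
  ... | inj₂ h∈rest = let i , ps , i<m , rest = ∈-consequences⁻ m h∈rest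
                      in i , ps , m<n⇒m<1+n i<m , rest

  consequences-mono : ∀ {L L′} m → L ⊆ᴸ L′ → consequences L m ⊆ᴸ consequences L′ m
  consequences-mono m L⊆L′ h∈ with ∈-consequences⁻ m h∈
  ... | i , ps , i<m , eq , ps⊆L = ∈-consequences⁺ (i , ps , i<m , eq , All.map L⊆L′ ps⊆L)

  consequences-sound : ∀ {X L} → InV e X → L ⊆ₗ X → ∀ m → consequences L m ⊆ₗ X
  consequences-sound {X} {L} X∈V L⊆X m = All.tabulate sound
    where
    sound : ∀ {h} → h ∈ₗ consequences L m → h ∈ X
    sound h∈ with ∈-consequences⁻ m h∈
    ... | i , ps , _ , eq , ps⊆L =
      subst (λ r → SatRule r X) eq (X∈V i) (All.map (All.lookup L⊆X) ps⊆L)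

  stage-monoˡ : ∀ {L L′} k → L ⊆ᴸ L′ → stage k L ⊆ᴸ stage k L′
  stage-monoˡ zero    L⊆L′ = L⊆L′
  stage-monoˡ (suc k) L⊆L′ = ++-mono (stage-monoˡ k L⊆L′) (consequences-mono k (stage-monoˡ k L⊆L′))

  stage-monoʳ : ∀ {L k k′} → k ≤ k′ → stage k L ⊆ᴸ stage k′ L
  stage-monoʳ = go ∘ ≤⇒≤′
    where
    go : ∀ {L k k′} → k ≤′ k′ → stage k L ⊆ᴸ stage k′ L
    go ≤′-refl                  = λ h∈ → h∈
    go {L} (≤′-step {k′} k≤′k′) = xs⊆xs++ys (stage k′ L) _ ∘ go k≤′k′

  stage-mono : ∀ {L L′ k k′} → k ≤ k′ → L ⊆ᴸ L′ → stage k L ⊆ᴸ stage k′ L′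
  stage-mono {k = k} k≤k′ L⊆L′ = stage-monoʳ k≤k′ ∘ stage-monoˡ k L⊆L′

  stage-sound : ∀ {X L} → InV e X → L ⊆ₗ X → ∀ k → stage k L ⊆ₗ X
  stage-sound X∈V L⊆X zero    = L⊆X
  stage-sound X∈V L⊆X (suc k) =
    ++⁺ (stage-sound X∈V L⊆X k) (consequences-sound X∈V (stage-sound X∈V L⊆X k) k)

  stage-closed : ∀ {L h ps i k} → e i ≡ just (h , ps) → i < k →
                 All (_∈ₗ stage k L) ps → h ∈ₗ stage (suc k) L
  stage-closed {L} {k = k} eq i<k ps⊆ = ∈-++⁺ʳ (stage k L) (∈-consequences⁺ (_ , _ , i<k , eq , ps⊆))

  Closure : List ℕ → Subset → Subset
  Closure G X y = ∃₂ λ F k → F ⊆ₗ X × y ∈ₗ stage k (G ++ F)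

  generators⊆Closure : ∀ {G X y} → y ∈ₗ G → y ∈ Closure G X
  generators⊆Closure {G} y∈G = [] , 0 , [] , ∈-++⁺ˡ y∈G

  ⊆-Closure : ∀ {G X} → X ⊆ Closure G X
  ⊆-Closure {G} y y∈X = y ∷ [] , 0 , y∈X ∷ [] , ∈-++⁺ʳ G (here refl)

  Closure-all : ∀ {G X ys} → ys ⊆ₗ Closure G X → ∃₂ λ F k → F ⊆ₗ X × All (_∈ₗ stage k (G ++ F)) ys
  Closure-all []                              = [] , 0 , [] , []
  Closure-all {G} ((F₁ , k₁ , F₁⊆X , y∈) ∷ ys⊆) with Closure-all ys⊆
  ... | F₂ , k₂ , F₂⊆X , ys∈ =
    F₁ ++ F₂ , k₁ ⊔ k₂ , ++⁺ F₁⊆X F₂⊆X ,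
    stage-mono (m≤m⊔n k₁ k₂) (++⁺ʳ G (xs⊆xs++ys F₁ F₂)) y∈ ∷
    All.map (stage-mono (m≤n⊔m k₁ k₂) (++⁺ʳ G (xs⊆ys++xs F₂ F₁))) ys∈

  Closure-InV : ∀ {G X} → InV e (Closure G X)
  Closure-InV i with e i in eq
  ... | nothing       = tt
  ... | just (h , ps) = λ ps⊆ →
    let F , k , F⊆X , ps∈ = Closure-all ps⊆
    in F , suc (k ⊔ suc i) , F⊆X ,
       stage-closed eq (m≤n⊔m k (suc i)) (All.map (stage-monoʳ (m≤m⊔n k (suc i))) ps∈)

module Certificates (e : REnum) (A : List ℕ) where
  open Stages e

  certify : ℕ → ℕ → List ℕ → Maybe (List ℕ)
  certify x k F with all? (_∈? stage k (x ∷ F)) A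
  ... | yes _ = just F
  ... | no _  = nothing

  certifier : EnumOp
  certifier x = uncurry (certify x) ∘ decode

  certify-complete : ∀ {X x k F} → All (_∈ₗ stage k (x ∷ F)) A → F ⊆ₗ X → certify x k F ⊑ X
  certify-complete {x = x} {k} {F} A⊆ F⊆X with all? (_∈? stage k (x ∷ F)) A
  ... | yes _ = F⊆X
  ... | no A⊈ = A⊈ A⊆

  certify-sound : ∀ {X x k F} → certify x k F ⊑ X → All (_∈ₗ stage k (x ∷ F)) A × F ⊆ₗ X
  certify-sound {x = x} {k} {F} certified with all? (_∈? stage k (x ∷ F)) A
  ... | yes A⊆ = A⊆ , certified

  Closure⇒certified : ∀ {X x} → A ⊆ₗ Closure (x ∷ []) X → ∃ λ n → certifier x n ⊑ X
  Closure⇒certified {X} {x} A⊆ with Closure-all A⊆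
  ... | F , k , F⊆X , A∈ with decode-surjective k F
  ... | n , decode-n =
    n , subst (λ p → uncurry (certify x) p ⊑ X) (sym decode-n) (certify-complete A∈ F⊆X)

  certified⇒∉ : ∀ {X x} → InV e X → (A ⊆ₗ X → X ≐ Whole) → ¬ (X ≐ Whole) →
                (∃ λ n → certifier x n ⊑ X) → ¬ x ∈ X
  certified⇒∉ {X} {x} X∈V A⊆X⇒whole X≠I (n , certified) x∈X =
    let k , F = decode n
        A∈ , F⊆X = certify-sound {X} {x} {k} {F} certified
    in X≠I (A⊆X⇒whole (All.map (All.lookup (stage-sound X∈V (x∈X ∷ F⊆X) k)) A∈))

  maximal-∉⇒certified : ∀ {X x} → (∀ Y → InV e Y → X ⊆ Y → (Y ≐ X) ⊎ (Y ≐ Whole)) →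
                        ¬ x ∈ X → ∃ λ n → certifier x n ⊑ X
  maximal-∉⇒certified {X} {x} maximal x∉X with maximal (Closure (x ∷ []) X) Closure-InV ⊆-Closure
  ... | inj₁ (Closure⊆X , _)     = ⊥-elim (x∉X (Closure⊆X x (generators⊆Closure (here refl))))
  ... | inj₂ (_ , Closure-whole) = Closure⇒certified (All.tabulate λ {a} _ → Closure-whole a tt)

mainTheorem6 : (e : REnum) → FinitelyPresented e →
    Σ EnumOp λ g → ∀ (X : Subset) → Maximal e X → ¬ (X ≐ Whole) → Compl X ≤e[ g ] X
mainTheorem6 e (A , finitelyPresented) = certifier , λ X (X∈V , maximal) X≠I x →
  maximal-∉⇒certified maximal , certified⇒∉ X∈V (finitelyPresented X X∈V) X≠I
  where open Certificates e A
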